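{- Let $(G,c,W,b)$ be an sVPND instance with $G=(V,E)$, $k=|W|$, and $b(j)=1$ for all $j\in W$, and consider a feasible virtual private network given by simple $i$-$j$-paths $P_{ij}$, $i,j\in W$, and capacities $u(e)$, $e\in E$. Then there exists a terminal $i\in W$ such that $$\sum_{e\in E}c(e)\,u(e)\ \ge\ \sum_{e\in E}c(e)\,y(e,\mathcal{P}_i),$$ where $\mathcal{P}_i=\{P_{ij}\mid j\in W\setminus\{i\}\}$.
   Context: sVPND instance: undirected graph $G=(V,E)$, costs $c:E\to\mathbb{R}_{\ge0}$, terminals $W\subseteq V$, bounds $b:W\to\mathbb{Z}_+$. A demand set $D=\{d_{ij}\}$ ($d_{ij}\ge0$ for unordered pairs of terminals, $d_{ii}=0$) is valid if $\sum_{j\in W}d_{ij}\le b(i)$ for all $i\in W$. A virtual private network, consisting of an $i$-$j$-path $P_{ij}$ for each unordered pair of distinct terminals and capacities $u(e)\ge0$, is feasible if $u(e)\ge\sum_{\{i,j\}:e\in P_{ij}}d_{ij}$ for all edges $e$ and all valid $D$. For a terminal $i$ and $\mathcal{P}_i$ as in the claim, $n(e,\mathcal{P}_i)=|\{j\in W\setminus\{i\}: e\in P_{ij}\}|$ and $y(e,\mathcal{P}_i)=\min\{n(e,\mathcal{P}_i),k-n(e,\mathcal{P}_i)\}$.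
   Formalization: The costs c(e) and capacities u(e) are nonnegative rationals instead of nonnegative reals, and the valid demand sets quantified over in the feasibility condition are taken in ℚ. -}

module Defs where

open import Data.Nat as ℕ using (ℕ; zero; suc; _⊓_; _∸_)
open import Data.Integer using (+_)
open import Data.Rational using (ℚ; 0ℚ; 1ℚ; _+_; _*_; _≤_; _/_)
open import Data.Fin using (Fin; zero; suc; _<?_)
open import Data.Fin.Properties using (_≟_)
open import Data.Product using (_×_; _,_)
open import Data.Sum using (_⊎_)
open import Data.List using (List; []; _∷_)
open import Data.List.Relation.Unary.Unique.Propositional using (Unique)
import Data.List.Membership.DecPropositional as DecMem
open import Relation.Binary.PropositionalEquality using (_≡_)
open import Relation.Nullary using (yes; no)

ℕtoℚ : ℕ → ℚ
ℕtoℚ n = + n / 1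

Σℚ : ∀ {k} → (Fin k → ℚ) → ℚ
Σℚ {zero}  f = 0ℚ
Σℚ {suc k} f = f zero + Σℚ (λ i → f (suc i))

Σℕ : ∀ {k} → (Fin k → ℕ) → ℕ
Σℕ {zero}  f = 0
Σℕ {suc k} f = f zero ℕ.+ Σℕ (λ i → f (suc i))

-- Graph G = (V,E) with V = Fin n, E = Fin m; edge e has endpoints ends e
-- (undirected: the order of the pair is irrelevant, see Joins).
Joins : ∀ {n m} → (Fin m → Fin n × Fin n) → Fin m → Fin n → Fin n → Set
Joins ends e v w = (ends e ≡ (v , w)) ⊎ (ends e ≡ (w , v))

-- Walk ends s t vs es : vs is the vertex sequence and es the edge sequence
-- of a walk from s to t.
data Walk {n m} (ends : Fin m → Fin n × Fin n)
     : Fin n → Fin n → List (Fin n) → List (Fin m) → Set where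
  nil  : ∀ v → Walk ends v v (v ∷ []) []
  cons : ∀ {v w t vs es} e → Joins ends e v w → Walk ends w t vs es
       → Walk ends v t (v ∷ vs) (e ∷ es)

SimplePath : ∀ {n m} → (Fin m → Fin n × Fin n)
           → Fin n → Fin n → List (Fin n) → List (Fin m) → Set
SimplePath ends s t vs es = Walk ends s t vs es × Unique vs

infix 4 _∈?ₑ_
_∈?ₑ_ : ∀ {m} (e : Fin m) (es : List (Fin m)) → _
_∈?ₑ_ {m} = DecMem._∈?_ (_≟_ {m})

load : ∀ {k m} → (Fin k → Fin k → List (Fin m)) → (Fin k → Fin k → ℚ)
     → Fin m → ℚ
load pe d e = Σℚ λ i → Σℚ λ j → pick i j
  where
  pick : _ → _ → ℚ
  pick i j with i <? j | e ∈?ₑ pe i j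
  ... | yes _ | yes _ = d i j
  ... | _     | _     = 0ℚ

-- valid demand set w.r.t. bounds b (demands indexed by terminals Fin k;
-- d symmetric encodes unordered pairs, d_ii = 0).
ValidDemand : ∀ {k} → (Fin k → ℕ) → (Fin k → Fin k → ℚ) → Set
ValidDemand b d =
  (∀ i j → 0ℚ ≤ d i j) × (∀ i j → d i j ≡ d j i) × (∀ i → d i i ≡ 0ℚ)
  × (∀ i → Σℚ (d i) ≤ ℕtoℚ (b i))

Feasible : ∀ {k m} → (Fin k → ℕ) → (Fin k → Fin k → List (Fin m))
         → (Fin m → ℚ) → Set
Feasible b pe u = ∀ d → ValidDemand b d → ∀ e → load pe d e ≤ u e

nCount : ∀ {k m} → (Fin k → Fin k → List (Fin m)) → Fin k → Fin m → ℕ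
nCount pe i e = Σℕ λ j → f j
  where
  f : _ → ℕ
  f j with j ≟ i | e ∈?ₑ pe i j
  ... | yes _ | _     = 0
  ... | no _  | yes _ = 1
  ... | no _  | no _  = 0

yVal : ∀ {m} (k : ℕ) → (Fin k → Fin k → List (Fin m)) → Fin k → Fin m → ℕ
yVal k pe i e = nCount pe i e ⊓ (k ∸ nCount pe i e)

-- Fix an edge e and write n_i = n(e, P_i). Giving every pair {i, j} whose
-- path uses e the demand 1/max(n_i, n_j) is valid for b ≡ 1, as terminal i
-- has exactly n_i such partners; so its load on e is at most u(e). Spreading
-- y_i = y(e, P_i) evenly over those n_i pairs, a pair receives
-- y_i/n_i + y_j/n_j ≤ (k − n)/n + 1 = k/n with n = max(n_i, n_j), whence
-- Σ_i y_i ≤ k · load(e) ≤ k · u(e). Weighting by c and summing over the edges,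
-- the k terminals together cost at most k Σ_e c(e) u(e), so one of them costs
-- at most the average.

module Submission where

open import Defs
open import Data.Nat using (ℕ; _≤_)
open import Data.Rational using (ℚ; 0ℚ; _*_) renaming (_≤_ to _≤ℚ_)
open import Data.Fin using (Fin)
open import Data.Product using (_×_; ∃)
open import Data.List using (List; reverse)
open import Function.Definitions using (Injective)
open import Relation.Binary.PropositionalEquality using (_≡_; _≢_)

open import Algebra.Bundles using (CommutativeRing)
open import Data.Nat as ℕ using (zero; suc; _⊓_; _⊔_; _∸_; s≤s; z≤n)
import Data.Nat.Properties as ℕ
import Data.Nat.Coprimality as Coprime
import Data.Integer as ℤ
import Data.Integer.Properties as ℤ
open import Data.Rational using (mkℚ; 1ℚ; _+_; _/_; 1/_; *≤*; _<_; nonNegative)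
import Data.Rational.Properties as ℚ
open import Data.Fin using (zero; suc; _<?_)
open import Data.Fin.Properties using (_≟_; any?; <-cmp; <-asym)
open import Data.Product using (_,_)
open import Data.Sum using (inj₁; inj₂)
open import Data.List.Membership.Propositional using (_∈_)
open import Data.List.Relation.Unary.Any.Properties using (reverse⁺)
open import Function using (_∘_)
open import Relation.Binary.Definitions using (tri<; tri≈; tri>)
open import Relation.Nullary using (¬_; yes; no; contradiction)
open import Relation.Binary.PropositionalEquality
  using (refl; sym; trans; cong; cong₂; subst; subst₂; module ≡-Reasoning)

open import Algebra.Properties.Semiring.Sum (CommutativeRing.semiring ℚ.+-*-commutativeRing)
  using (sum; sum-cong-≗; ∑-comm; ∑-distrib-+; *-distribˡ-sum; *-distribʳ-sum)
open import Algebra.Properties.CommutativeSemigroup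
  (CommutativeRing.*-commutativeSemigroup ℚ.+-*-commutativeRing) using () renaming (x∙yz≈y∙xz to *-swapˡ)

-- ℕtoℚ n in normal form, on which the NonZero instance required by 1/_ reduces.
fromℕ : ℕ → ℚ
fromℕ n = mkℚ (ℤ.+ n) 0 (Coprime.sym (Coprime.1-coprimeTo n))

ℕtoℚ≡fromℕ : ∀ n → ℕtoℚ n ≡ fromℕ n
ℕtoℚ≡fromℕ n = ℚ.normalize-coprime (Coprime.sym (Coprime.1-coprimeTo n))

ℕtoℚ-+ : ∀ a b → ℕtoℚ (a ℕ.+ b) ≡ ℕtoℚ a + ℕtoℚ b
ℕtoℚ-+ a b rewrite ℕtoℚ≡fromℕ a | ℕtoℚ≡fromℕ b =
  cong (_/ 1) (trans (ℤ.pos-+ a b) (sym (cong₂ ℤ._+_ (ℤ.*-identityʳ (ℤ.+ a)) (ℤ.*-identityʳ (ℤ.+ b)))))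

ℕtoℚ-mono-≤ : ∀ {a b} → a ≤ b → ℕtoℚ a ≤ℚ ℕtoℚ b
ℕtoℚ-mono-≤ {a} {b} a≤b rewrite ℕtoℚ≡fromℕ a | ℕtoℚ≡fromℕ b =
  *≤* (subst₂ ℤ._≤_ (sym (ℤ.*-identityʳ (ℤ.+ a))) (sym (ℤ.*-identityʳ (ℤ.+ b))) (ℤ.+≤+ a≤b))

ℕtoℚ-nonNeg : ∀ n → 0ℚ ≤ℚ ℕtoℚ n
ℕtoℚ-nonNeg n = ℕtoℚ-mono-≤ {0} {n} z≤n

ℕtoℚ-Σ : ∀ {k} (h : Fin k → ℕ) → ℕtoℚ (Σℕ h) ≡ Σℚ (ℕtoℚ ∘ h)
ℕtoℚ-Σ {zero}  h = refl
ℕtoℚ-Σ {suc k} h = trans (ℕtoℚ-+ (h zero) _) (cong (ℕtoℚ (h zero) +_) (ℕtoℚ-Σ (h ∘ suc)))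

-- 1/n, with the junk value inv⁺ 0 = 1.
inv⁺ : ℕ → ℚ
inv⁺ n = 1/ fromℕ (suc (n ∸ 1))

inv⁺-nonNeg : ∀ n → 0ℚ ≤ℚ inv⁺ n
inv⁺-nonNeg n = *≤* (ℤ.+≤+ z≤n)

inv⁺-antimono : ∀ {a b} → a ≤ b → inv⁺ b ≤ℚ inv⁺ a
inv⁺-antimono {a} {b} a≤b =
  *≤* (subst₂ ℤ._≤_ (sym (ℤ.*-identityˡ _)) (sym (ℤ.*-identityˡ _)) (ℤ.+≤+ (s≤s (ℕ.∸-monoˡ-≤ 1 a≤b))))

ℕtoℚ-*-inv⁺ : ∀ n → 1 ≤ n → ℕtoℚ n * inv⁺ n ≡ 1ℚ
ℕtoℚ-*-inv⁺ (suc t) _ rewrite ℕtoℚ≡fromℕ (suc t) = ℚ.*-inverseʳ (fromℕ (suc t))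

ℕtoℚ-*-inv⁺-≤1 : ∀ n → ℕtoℚ n * inv⁺ n ≤ℚ 1ℚ
ℕtoℚ-*-inv⁺-≤1 zero    = ℚ.≤-trans (ℚ.≤-reflexive (ℚ.*-zeroˡ (inv⁺ 0))) (ℕtoℚ-nonNeg 1)
ℕtoℚ-*-inv⁺-≤1 (suc t) = ℚ.≤-reflexive (ℕtoℚ-*-inv⁺ (suc t) (s≤s z≤n))

ℕtoℚ-*-inv⁺-cancel : ∀ {y n} → y ≤ n → ℕtoℚ n * (ℕtoℚ y * inv⁺ n) ≡ ℕtoℚ y
ℕtoℚ-*-inv⁺-cancel {n = zero}  z≤n = ℚ.*-zeroˡ (ℕtoℚ 0 * inv⁺ 0)
ℕtoℚ-*-inv⁺-cancel {y} {suc t} _ = begin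
  ℕtoℚ (suc t) * (ℕtoℚ y * inv⁺ (suc t)) ≡⟨ *-swapˡ (ℕtoℚ (suc t)) (ℕtoℚ y) (inv⁺ (suc t)) ⟩
  ℕtoℚ y * (ℕtoℚ (suc t) * inv⁺ (suc t)) ≡⟨ cong (ℕtoℚ y *_) (ℕtoℚ-*-inv⁺ (suc t) (s≤s z≤n)) ⟩
  ℕtoℚ y * 1ℚ                            ≡⟨ ℚ.*-identityʳ (ℕtoℚ y) ⟩
  ℕtoℚ y                                 ∎
  where open ≡-Reasoning

*-nonNeg : ∀ {a b} → 0ℚ ≤ℚ a → 0ℚ ≤ℚ b → 0ℚ ≤ℚ a * b
*-nonNeg {a} {b} 0≤a 0≤b = ℚ.nonNegative⁻¹ (a * b) {{ℚ.nonNeg*nonNeg⇒nonNeg a {{nonNegative 0≤a}} b {{nonNegative 0≤b}}}}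

*-monoˡ-≤-nonNeg : ∀ {r p q} → 0ℚ ≤ℚ r → p ≤ℚ q → r * p ≤ℚ r * q
*-monoˡ-≤-nonNeg {r} 0≤r = ℚ.*-monoˡ-≤-nonNeg r {{nonNegative 0≤r}}

*-monoʳ-≤-nonNeg : ∀ {r p q} → 0ℚ ≤ℚ r → p ≤ℚ q → p * r ≤ℚ q * r
*-monoʳ-≤-nonNeg {r} 0≤r = ℚ.*-monoʳ-≤-nonNeg r {{nonNegative 0≤r}}

Σℚ≡sum : ∀ {k} (f : Fin k → ℚ) → Σℚ f ≡ sum f
Σℚ≡sum {zero}  f = refl
Σℚ≡sum {suc k} f = cong (f zero +_) (Σℚ≡sum (f ∘ suc))

Σℚ-cong : ∀ {k} {f g : Fin k → ℚ} → (∀ j → f j ≡ g j) → Σℚ f ≡ Σℚ g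
Σℚ-cong {f = f} {g} f≗g = trans (Σℚ≡sum f) (trans (sum-cong-≗ f≗g) (sym (Σℚ≡sum g)))

Σℚ-+ : ∀ {k} (f g : Fin k → ℚ) → Σℚ (λ j → f j + g j) ≡ Σℚ f + Σℚ g
Σℚ-+ f g = trans (Σℚ≡sum (λ j → f j + g j)) (trans (∑-distrib-+ f g) (sym (cong₂ _+_ (Σℚ≡sum f) (Σℚ≡sum g))))

Σℚ-*ˡ : ∀ {k} c (f : Fin k → ℚ) → Σℚ (λ j → c * f j) ≡ c * Σℚ f
Σℚ-*ˡ c f = trans (Σℚ≡sum (λ j → c * f j)) (trans (sym (*-distribˡ-sum c f)) (cong (c *_) (sym (Σℚ≡sum f))))

Σℚ-*ʳ : ∀ {k} c (f : Fin k → ℚ) → Σℚ (λ j → f j * c) ≡ Σℚ f * c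
Σℚ-*ʳ c f = trans (Σℚ≡sum (λ j → f j * c)) (trans (sym (*-distribʳ-sum c f)) (cong (_* c) (sym (Σℚ≡sum f))))

Σℚ-comm : ∀ {a b} (f : Fin a → Fin b → ℚ) →
          Σℚ (λ i → Σℚ (λ j → f i j)) ≡ Σℚ (λ j → Σℚ (λ i → f i j))
Σℚ-comm f = begin
  Σℚ (λ i → Σℚ (f i))             ≡⟨ Σℚ-cong (λ i → Σℚ≡sum (f i)) ⟩
  Σℚ (λ i → sum (f i))            ≡⟨ Σℚ≡sum (λ i → sum (f i)) ⟩
  sum (λ i → sum (f i))           ≡⟨ ∑-comm f ⟩
  sum (λ j → sum (λ i → f i j))   ≡⟨ sym (Σℚ≡sum (λ j → sum (λ i → f i j))) ⟩
  Σℚ (λ j → sum (λ i → f i j))    ≡⟨ sym (Σℚ-cong (λ j → Σℚ≡sum (λ i → f i j))) ⟩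
  Σℚ (λ j → Σℚ (λ i → f i j))     ∎
  where open ≡-Reasoning

Σℚ-mono-≤ : ∀ {k} {f g : Fin k → ℚ} → (∀ j → f j ≤ℚ g j) → Σℚ f ≤ℚ Σℚ g
Σℚ-mono-≤ {zero}  f≤g = ℚ.≤-refl
Σℚ-mono-≤ {suc k} f≤g = ℚ.+-mono-≤ (f≤g zero) (Σℚ-mono-≤ (f≤g ∘ suc))

Σℚ-mono-< : ∀ {k} {f g : Fin (suc k) → ℚ} → (∀ j → f j < g j) → Σℚ f < Σℚ g
Σℚ-mono-< f<g = ℚ.+-mono-<-≤ (f<g zero) (Σℚ-mono-≤ (ℚ.<⇒≤ ∘ f<g ∘ suc))

Σℚ-const : ∀ k x → Σℚ {k} (λ _ → x) ≡ ℕtoℚ k * x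
Σℚ-const zero    x = sym (ℚ.*-zeroˡ x)
Σℚ-const (suc k) x = begin
  x + Σℚ {k} (λ _ → x)      ≡⟨ cong₂ _+_ (sym (ℚ.*-identityˡ x)) (Σℚ-const k x) ⟩
  1ℚ * x + ℕtoℚ k * x       ≡⟨ sym (ℚ.*-distribʳ-+ x 1ℚ (ℕtoℚ k)) ⟩
  (1ℚ + ℕtoℚ k) * x         ≡⟨ cong (_* x) (sym (ℕtoℚ-+ 1 k)) ⟩
  ℕtoℚ (suc k) * x          ∎
  where open ≡-Reasoning

Σℕ-cong : ∀ {k} {f g : Fin k → ℕ} → (∀ j → f j ≡ g j) → Σℕ f ≡ Σℕ g
Σℕ-cong {zero}  f≗g = refl
Σℕ-cong {suc k} f≗g = cong₂ ℕ._+_ (f≗g zero) (Σℕ-cong (f≗g ∘ suc))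

Σℕ-≤-length : ∀ {k} (h : Fin k → ℕ) → (∀ j → h j ≤ 1) → Σℕ h ≤ k
Σℕ-≤-length {zero}  h h≤1 = z≤n
Σℕ-≤-length {suc k} h h≤1 = ℕ.+-mono-≤ (h≤1 zero) (Σℕ-≤-length (h ∘ suc) (h≤1 ∘ suc))

term≤Σℕ : ∀ {k} (h : Fin k → ℕ) j → h j ≤ Σℕ h
term≤Σℕ h zero    = ℕ.m≤m+n (h zero) _
term≤Σℕ h (suc j) = ℕ.≤-trans (term≤Σℕ (h ∘ suc) j) (ℕ.m≤n+m _ (h zero))

exists-≤-average : ∀ {k} (a : Fin (suc k) → ℚ) B → Σℚ a ≤ℚ ℕtoℚ (suc k) * B → ∃ λ i → a i ≤ℚ B
exists-≤-average {k} a B Σa≤ with any? (λ i → a i ℚ.≤? B)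
... | yes found = found
... | no none   = contradiction (ℚ.<-≤-trans (subst (_< Σℚ a) (Σℚ-const (suc k) B) B<Σa) Σa≤) (ℚ.<-irrefl refl)
  where
  B<Σa : Σℚ {suc k} (λ _ → B) < Σℚ a
  B<Σa = Σℚ-mono-< (λ i → ℚ.≰⇒> (λ a≤B → none (i , a≤B)))

when< : ∀ {k} → Fin k → Fin k → ℚ → ℚ
when< i j x with i <? j
... | yes _ = x
... | no _  = 0ℚ

Σ< : ∀ {k} → (Fin k → Fin k → ℚ) → ℚ
Σ< a = Σℚ λ i → Σℚ λ j → when< i j (a i j)

when<-+ : ∀ {k} (i j : Fin k) x y → when< i j x + when< i j y ≡ when< i j (x + y)
when<-+ i j x y with i <? j
... | yes _ = refl
... | no _  = ℚ.+-identityˡ 0ℚ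

when<-*ˡ : ∀ {k} (i j : Fin k) c x → when< i j (c * x) ≡ c * when< i j x
when<-*ˡ i j c x with i <? j
... | yes _ = refl
... | no _  = sym (ℚ.*-zeroʳ c)

when<-mono-≤ : ∀ {k} (i j : Fin k) {x y} → x ≤ℚ y → when< i j x ≤ℚ when< i j y
when<-mono-≤ i j x≤y with i <? j
... | yes _ = x≤y
... | no _  = ℚ.≤-refl

when<-split : ∀ {k} (i j : Fin k) x → (i ≡ j → x ≡ 0ℚ) → x ≡ when< i j x + when< j i x
when<-split i j x diag with i <? j | j <? i
... | yes i<j | yes j<i = contradiction j<i (<-asym i<j)
... | yes _   | no _    = sym (ℚ.+-identityʳ x)
... | no _    | yes _   = sym (ℚ.+-identityˡ x)
... | no i≮j  | no j≮i with <-cmp i j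
...   | tri< i<j _ _ = contradiction i<j i≮j
...   | tri≈ _ i≡j _ = diag i≡j
...   | tri> _ _ j<i = contradiction j<i j≮i

ΣΣ-+ : ∀ {k} (a b : Fin k → Fin k → ℚ) →
       Σℚ (λ i → Σℚ (λ j → a i j + b i j)) ≡ Σℚ (λ i → Σℚ (a i)) + Σℚ (λ i → Σℚ (b i))
ΣΣ-+ a b = trans (Σℚ-cong (λ i → Σℚ-+ (a i) (b i))) (Σℚ-+ (λ i → Σℚ (a i)) (λ i → Σℚ (b i)))

ΣΣ≡Σ<-symmetrised : ∀ {k} (a : Fin k → Fin k → ℚ) → (∀ i → a i i ≡ 0ℚ) →
                    Σℚ (λ i → Σℚ (a i)) ≡ Σ< (λ i j → a i j + a j i)
ΣΣ≡Σ<-symmetrised a diag = begin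
  Σℚ (λ i → Σℚ (a i))
    ≡⟨ Σℚ-cong (λ i → Σℚ-cong (λ j → when<-split i j (a i j) (λ { refl → diag i }))) ⟩
  Σℚ (λ i → Σℚ (λ j → when< i j (a i j) + when< j i (a i j)))
    ≡⟨ ΣΣ-+ (λ i j → when< i j (a i j)) (λ i j → when< j i (a i j)) ⟩
  Σ< a + Σℚ (λ i → Σℚ (λ j → when< j i (a i j)))
    ≡⟨ cong (Σ< a +_) (Σℚ-comm (λ i j → when< j i (a i j))) ⟩
  Σ< a + Σ< (λ i j → a j i)
    ≡⟨ sym (ΣΣ-+ (λ i j → when< i j (a i j)) (λ i j → when< i j (a j i))) ⟩
  Σℚ (λ i → Σℚ (λ j → when< i j (a i j) + when< i j (a j i)))
    ≡⟨ Σℚ-cong (λ i → Σℚ-cong (λ j → when<-+ i j (a i j) (a j i))) ⟩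
  Σ< (λ i j → a i j + a j i) ∎
  where open ≡-Reasoning

Σ<-mono-≤ : ∀ {k} {a b : Fin k → Fin k → ℚ} → (∀ i j → a i j ≤ℚ b i j) → Σ< a ≤ℚ Σ< b
Σ<-mono-≤ a≤b = Σℚ-mono-≤ (λ i → Σℚ-mono-≤ (λ j → when<-mono-≤ i j (a≤b i j)))

Σ<-*ˡ : ∀ {k} c (a : Fin k → Fin k → ℚ) → Σ< (λ i j → c * a i j) ≡ c * Σ< a
Σ<-*ˡ c a = begin
  Σ< (λ i j → c * a i j)                           ≡⟨ Σℚ-cong (λ i → Σℚ-cong (λ j → when<-*ˡ i j c (a i j))) ⟩
  Σℚ (λ i → Σℚ (λ j → c * when< i j (a i j)))      ≡⟨ Σℚ-cong (λ i → Σℚ-*ˡ c (λ j → when< i j (a i j))) ⟩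
  Σℚ (λ i → c * Σℚ (λ j → when< i j (a i j)))      ≡⟨ Σℚ-*ˡ c (λ i → Σℚ (λ j → when< i j (a i j))) ⟩
  c * Σ< a                                         ∎
  where open ≡-Reasoning

yPerPath : ℕ → ℕ → ℚ
yPerPath k n = ℕtoℚ (n ⊓ (k ∸ n)) * inv⁺ n

yPerPath≤1 : ∀ k n → yPerPath k n ≤ℚ 1ℚ
yPerPath≤1 k n = ℚ.≤-trans (*-monoʳ-≤-nonNeg (inv⁺-nonNeg n) (ℕtoℚ-mono-≤ (ℕ.m⊓n≤m n (k ∸ n))))
                           (ℕtoℚ-*-inv⁺-≤1 n)

yPerPath≤complement : ∀ k n → yPerPath k n ≤ℚ ℕtoℚ (k ∸ n) * inv⁺ n
yPerPath≤complement k n = *-monoʳ-≤-nonNeg (inv⁺-nonNeg n) (ℕtoℚ-mono-≤ (ℕ.m⊓n≤n n (k ∸ n)))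

yPerPath-+-yPerPath≤ : ∀ {k a} b → 1 ≤ a → a ≤ k → yPerPath k a + yPerPath k b ≤ℚ ℕtoℚ k * inv⁺ a
yPerPath-+-yPerPath≤ {k} {a} b 1≤a a≤k = begin
  yPerPath k a + yPerPath k b                ≤⟨ ℚ.+-mono-≤ (yPerPath≤complement k a) (yPerPath≤1 k b) ⟩
  ℕtoℚ (k ∸ a) * inv⁺ a + 1ℚ                 ≡⟨ cong (ℕtoℚ (k ∸ a) * inv⁺ a +_) (sym (ℕtoℚ-*-inv⁺ a 1≤a)) ⟩
  ℕtoℚ (k ∸ a) * inv⁺ a + ℕtoℚ a * inv⁺ a    ≡⟨ sym (ℚ.*-distribʳ-+ (inv⁺ a) (ℕtoℚ (k ∸ a)) (ℕtoℚ a)) ⟩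
  (ℕtoℚ (k ∸ a) + ℕtoℚ a) * inv⁺ a           ≡⟨ cong (_* inv⁺ a) (sym (ℕtoℚ-+ (k ∸ a) a)) ⟩
  ℕtoℚ (k ∸ a ℕ.+ a) * inv⁺ a                ≡⟨ cong (λ n → ℕtoℚ n * inv⁺ a) (ℕ.m∸n+n≡m a≤k) ⟩
  ℕtoℚ k * inv⁺ a                            ∎
  where open ℚ.≤-Reasoning

yPerPath-+-yPerPath≤max : ∀ {k a b} → 1 ≤ a → 1 ≤ b → a ≤ k → b ≤ k →
                          yPerPath k a + yPerPath k b ≤ℚ ℕtoℚ k * inv⁺ (a ⊔ b)
yPerPath-+-yPerPath≤max {k} {a} {b} 1≤a 1≤b a≤k b≤k with ℕ.≤-total b a
... | inj₁ b≤a rewrite ℕ.m≥n⇒m⊔n≡m b≤a = yPerPath-+-yPerPath≤ b 1≤a a≤k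
... | inj₂ a≤b rewrite ℕ.m≤n⇒m⊔n≡n a≤b =
  subst (_≤ℚ ℕtoℚ k * inv⁺ b) (ℚ.+-comm (yPerPath k b) (yPerPath k a)) (yPerPath-+-yPerPath≤ a 1≤b b≤k)

ℕtoℚ-*-monoˡ-≤-if-pos : ∀ n {x y} → (1 ≤ n → x ≤ℚ y) → ℕtoℚ n * x ≤ℚ ℕtoℚ n * y
ℕtoℚ-*-monoˡ-≤-if-pos zero    {x} {y} _   = ℚ.≤-reflexive (trans (ℚ.*-zeroˡ x) (sym (ℚ.*-zeroˡ y)))
ℕtoℚ-*-monoˡ-≤-if-pos (suc n) x≤y = *-monoˡ-≤-nonNeg (ℕtoℚ-nonNeg (suc n)) (x≤y (s≤s z≤n))

-- The demand of a symmetric 0/1 matrix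

module Adjacency {k} (h : Fin k → Fin k → ℕ) (h≤1 : ∀ i j → h i j ≤ 1)
                 (h-sym : ∀ i j → h i j ≡ h j i) (h-diag : ∀ i → h i i ≡ 0) where

  deg : Fin k → ℕ
  deg i = Σℕ (h i)

  demand : Fin k → Fin k → ℚ
  demand i j = ℕtoℚ (h i j) * inv⁺ (deg i ⊔ deg j)

  deg≤k : ∀ i → deg i ≤ k
  deg≤k i = Σℕ-≤-length (h i) (h≤1 i)

  1≤deg : ∀ i j → 1 ≤ h i j → 1 ≤ deg i
  1≤deg i j 1≤h = ℕ.≤-trans 1≤h (term≤Σℕ (h i) j)

  Σ-row-*ʳ : ∀ i x → Σℚ (λ j → ℕtoℚ (h i j) * x) ≡ ℕtoℚ (deg i) * x
  Σ-row-*ʳ i x = trans (Σℚ-*ʳ x (ℕtoℚ ∘ h i)) (cong (_* x) (sym (ℕtoℚ-Σ (h i))))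

  demand-row≤1 : ∀ i → Σℚ (demand i) ≤ℚ 1ℚ
  demand-row≤1 i = begin
    Σℚ (demand i)                             ≤⟨ Σℚ-mono-≤ (λ j → *-monoˡ-≤-nonNeg (ℕtoℚ-nonNeg (h i j))
                                                   (inv⁺-antimono (ℕ.m≤m⊔n (deg i) (deg j)))) ⟩
    Σℚ (λ j → ℕtoℚ (h i j) * inv⁺ (deg i))    ≡⟨ Σ-row-*ʳ i (inv⁺ (deg i)) ⟩
    ℕtoℚ (deg i) * inv⁺ (deg i)               ≤⟨ ℕtoℚ-*-inv⁺-≤1 (deg i) ⟩
    1ℚ                                        ∎
    where open ℚ.≤-Reasoning

  demand-valid : ValidDemand (λ _ → 1) demand
  demand-valid =
      (λ i j → *-nonNeg (ℕtoℚ-nonNeg (h i j)) (inv⁺-nonNeg (deg i ⊔ deg j)))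
    , (λ i j → cong₂ (λ x n → ℕtoℚ x * inv⁺ n) (h-sym i j) (ℕ.⊔-comm (deg i) (deg j)))
    , (λ i → trans (cong (λ x → ℕtoℚ x * inv⁺ (deg i ⊔ deg i)) (h-diag i)) (ℚ.*-zeroˡ (inv⁺ (deg i ⊔ deg i))))
    , demand-row≤1

  share : Fin k → Fin k → ℚ
  share i j = ℕtoℚ (h i j) * yPerPath k (deg i)

  Σ-share : ∀ i → Σℚ (share i) ≡ ℕtoℚ (deg i ⊓ (k ∸ deg i))
  Σ-share i = trans (Σ-row-*ʳ i (yPerPath k (deg i))) (ℕtoℚ-*-inv⁺-cancel (ℕ.m⊓n≤m (deg i) (k ∸ deg i)))

  share-pair≤ : ∀ i j → share i j + share j i ≤ℚ ℕtoℚ k * demand i j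
  share-pair≤ i j = begin
    share i j + share j i
      ≡⟨ cong (λ x → share i j + ℕtoℚ x * yPerPath k (deg j)) (h-sym j i) ⟩
    ℕtoℚ (h i j) * yPerPath k (deg i) + ℕtoℚ (h i j) * yPerPath k (deg j)
      ≡⟨ sym (ℚ.*-distribˡ-+ (ℕtoℚ (h i j)) (yPerPath k (deg i)) (yPerPath k (deg j))) ⟩
    ℕtoℚ (h i j) * (yPerPath k (deg i) + yPerPath k (deg j))
      ≤⟨ ℕtoℚ-*-monoˡ-≤-if-pos (h i j) (λ 1≤h →
           yPerPath-+-yPerPath≤max (1≤deg i j 1≤h) (1≤deg j i (subst (1 ≤_) (h-sym i j) 1≤h)) (deg≤k i) (deg≤k j)) ⟩
    ℕtoℚ (h i j) * (ℕtoℚ k * inv⁺ (deg i ⊔ deg j))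
      ≡⟨ *-swapˡ (ℕtoℚ (h i j)) (ℕtoℚ k) (inv⁺ (deg i ⊔ deg j)) ⟩
    ℕtoℚ k * demand i j ∎
    where open ℚ.≤-Reasoning

  Σ-y≤k*Σ<demand : Σℚ (λ i → ℕtoℚ (deg i ⊓ (k ∸ deg i))) ≤ℚ ℕtoℚ k * Σ< demand
  Σ-y≤k*Σ<demand = begin
    Σℚ (λ i → ℕtoℚ (deg i ⊓ (k ∸ deg i)))   ≡⟨ Σℚ-cong (λ i → sym (Σ-share i)) ⟩
    Σℚ (λ i → Σℚ (share i))                 ≡⟨ ΣΣ≡Σ<-symmetrised share share-diag ⟩
    Σ< (λ i j → share i j + share j i)      ≤⟨ Σ<-mono-≤ share-pair≤ ⟩
    Σ< (λ i j → ℕtoℚ k * demand i j)        ≡⟨ Σ<-*ˡ (ℕtoℚ k) demand ⟩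
    ℕtoℚ k * Σ< demand                      ∎
    where
    open ℚ.≤-Reasoning
    share-diag : ∀ i → share i i ≡ 0ℚ
    share-diag i = trans (cong (λ x → ℕtoℚ x * yPerPath k (deg i)) (h-diag i)) (ℚ.*-zeroˡ (yPerPath k (deg i)))

-- Pairs whose path uses a given edge

module EdgeUse {k m} (pe : Fin k → Fin k → List (Fin m))
               (pe-sym : ∀ i j → pe j i ≡ reverse (pe i j)) (e : Fin m) where

  uses : Fin k → Fin k → ℕ
  uses i j with j ≟ i | e ∈?ₑ pe i j
  ... | yes _ | _     = 0
  ... | no _  | yes _ = 1
  ... | no _  | no _  = 0

  -- The left-hand side is the local counting function of nCount, which has no
  -- name; it is solved from the use in nCount≡Σuses (likewise for load-agrees).
  uses-agrees : ∀ i j → _ ≡ uses i j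

  nCount≡Σuses : ∀ i → nCount pe i e ≡ Σℕ (uses i)
  nCount≡Σuses i = Σℕ-cong (uses-agrees i)

  uses-agrees i j with j ≟ i | e ∈?ₑ pe i j
  ... | yes _ | _     = refl
  ... | no _  | yes _ = refl
  ... | no _  | no _  = refl

  uses≤1 : ∀ i j → uses i j ≤ 1
  uses≤1 i j with j ≟ i | e ∈?ₑ pe i j
  ... | yes _ | _     = z≤n
  ... | no _  | yes _ = s≤s z≤n
  ... | no _  | no _  = z≤n

  uses-diag : ∀ i → uses i i ≡ 0
  uses-diag i with i ≟ i
  ... | yes _ = refl
  ... | no i≢i = contradiction refl i≢i

  ∈-pe-sym : ∀ i j → e ∈ pe i j → e ∈ pe j i
  ∈-pe-sym i j e∈ rewrite pe-sym i j = reverse⁺ e∈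

  uses-sym : ∀ i j → uses i j ≡ uses j i
  uses-sym i j with j ≟ i | i ≟ j
  ... | yes _   | yes _   = refl
  ... | yes j≡i | no i≢j  = contradiction (sym j≡i) i≢j
  ... | no j≢i  | yes i≡j = contradiction (sym i≡j) j≢i
  ... | no _    | no _ with e ∈?ₑ pe i j | e ∈?ₑ pe j i
  ...   | yes _  | yes _  = refl
  ...   | yes e∈ | no e∉  = contradiction (∈-pe-sym i j e∈) e∉
  ...   | no e∉  | yes e∈ = contradiction (∈-pe-sym j i e∈) e∉
  ...   | no _   | no _   = refl

  uses-∉ : ∀ i j → ¬ (e ∈ pe i j) → uses i j ≡ 0
  uses-∉ i j e∉ with j ≟ i | e ∈?ₑ pe i j
  ... | yes _ | _      = refl
  ... | no _  | yes e∈ = contradiction e∈ e∉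
  ... | no _  | no _   = refl

  load-agrees : ∀ d → (∀ i j → ¬ (e ∈ pe i j) → d i j ≡ 0ℚ) → ∀ i j → _ ≡ when< i j (d i j)

  load≡Σ< : ∀ d → (∀ i j → ¬ (e ∈ pe i j) → d i j ≡ 0ℚ) → load pe d e ≡ Σ< d
  load≡Σ< d off = Σℚ-cong λ i → Σℚ-cong (load-agrees d off i)

  load-agrees d off i j with i <? j | e ∈?ₑ pe i j
  ... | yes _ | yes _ = refl
  ... | yes _ | no e∉ = sym (off i j e∉)
  ... | no _  | _     = refl

  open Adjacency uses uses≤1 uses-sym uses-diag

  demand-off-path : ∀ i j → ¬ (e ∈ pe i j) → demand i j ≡ 0ℚ
  demand-off-path i j e∉ =
    trans (cong (λ x → ℕtoℚ x * inv⁺ (deg i ⊔ deg j)) (uses-∉ i j e∉)) (ℚ.*-zeroˡ (inv⁺ (deg i ⊔ deg j)))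

  Σ-yVal≤ : ∀ u → Feasible (λ _ → 1) pe u → Σℚ (λ i → ℕtoℚ (yVal k pe i e)) ≤ℚ ℕtoℚ k * u e
  Σ-yVal≤ u feasible = begin
    Σℚ (λ i → ℕtoℚ (yVal k pe i e))
      ≡⟨ Σℚ-cong (λ i → cong (λ n → ℕtoℚ (n ⊓ (k ∸ n))) (nCount≡Σuses i)) ⟩
    Σℚ (λ i → ℕtoℚ (deg i ⊓ (k ∸ deg i)))   ≤⟨ Σ-y≤k*Σ<demand ⟩
    ℕtoℚ k * Σ< demand                      ≡⟨ cong (ℕtoℚ k *_) (sym (load≡Σ< demand demand-off-path)) ⟩
    ℕtoℚ k * load pe demand e               ≤⟨ *-monoˡ-≤-nonNeg (ℕtoℚ-nonNeg k) (feasible demand demand-valid e) ⟩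
    ℕtoℚ k * u e                            ∎
    where open ℚ.≤-Reasoning

ΣΣ-weighted≤ : ∀ {k m} (c : Fin m → ℚ) → (∀ e → 0ℚ ≤ℚ c e) → (x : Fin k → Fin m → ℚ) (u : Fin m → ℚ) (K : ℚ) →
               (∀ e → Σℚ (λ i → x i e) ≤ℚ K * u e) →
               Σℚ (λ i → Σℚ (λ e → c e * x i e)) ≤ℚ K * Σℚ (λ e → c e * u e)
ΣΣ-weighted≤ c c≥0 x u K Σx≤ = begin
  Σℚ (λ i → Σℚ (λ e → c e * x i e))   ≡⟨ Σℚ-comm (λ i e → c e * x i e) ⟩
  Σℚ (λ e → Σℚ (λ i → c e * x i e))   ≡⟨ Σℚ-cong (λ e → Σℚ-*ˡ (c e) (λ i → x i e)) ⟩
  Σℚ (λ e → c e * Σℚ (λ i → x i e))   ≤⟨ Σℚ-mono-≤ (λ e → *-monoˡ-≤-nonNeg (c≥0 e) (Σx≤ e)) ⟩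
  Σℚ (λ e → c e * (K * u e))          ≡⟨ Σℚ-cong (λ e → *-swapˡ (c e) K (u e)) ⟩
  Σℚ (λ e → K * (c e * u e))          ≡⟨ Σℚ-*ˡ K (λ e → c e * u e) ⟩
  K * Σℚ (λ e → c e * u e)            ∎
  where open ℚ.≤-Reasoning

lemma3 : ∀ {n m k : ℕ}
    (ends : Fin m → Fin n × Fin n)
    (term : Fin k → Fin n) → Injective _≡_ _≡_ term → 1 ≤ k
    → (c : Fin m → ℚ) → (∀ e → 0ℚ ≤ℚ c e)
    → (pv : Fin k → Fin k → List (Fin n))
    → (pe : Fin k → Fin k → List (Fin m))
    → (∀ i j → i ≢ j → SimplePath ends (term i) (term j) (pv i j) (pe i j))
    → (∀ i j → pv j i ≡ reverse (pv i j))
    → (∀ i j → pe j i ≡ reverse (pe i j))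
    → (u : Fin m → ℚ) → (∀ e → 0ℚ ≤ℚ u e)
    → Feasible (λ _ → 1) pe u
    → ∃ λ (i : Fin k) →
        Σℚ (λ e → c e * ℕtoℚ (yVal k pe i e)) ≤ℚ Σℚ (λ e → c e * u e)
lemma3 {k = suc k} _ _ _ _ c c≥0 _ pe _ _ pe-sym u _ feasible =
  exists-≤-average (λ i → Σℚ (λ e → c e * ℕtoℚ (yVal (suc k) pe i e))) (Σℚ (λ e → c e * u e))
    (ΣΣ-weighted≤ c c≥0 (λ i e → ℕtoℚ (yVal (suc k) pe i e)) u (ℕtoℚ (suc k))
      (λ e → EdgeUse.Σ-yVal≤ pe pe-sym e u feasible))
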